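{- For every $n\ge1$, $d_1d_2\cdots d_n\,u_nu_{n-1}\cdots u_1-1\in J$.
   Context: $\mathcal U$ is the free associative $\mathbf C$-algebra on generators $u_i$ and $d_i$, $i\ge1$, with identity $1$. $J$ is the two-sided ideal of $\mathcal U$ generated by $u_iu_j-u_ju_i$ ($|i-j|\ge2$), $d_id_j-d_jd_i$ ($|i-j|\ge2$), $d_iu_j-u_jd_i$ ($i\ne j$), $d_1u_1-1$, and $d_{i+1}u_{i+1}-u_id_i$ ($i\ge1$). -}

module Defs where

open import Level using (_⊔_)
open import Algebra.Bundles using (CommutativeRing)
open import Data.Nat.Base using (ℕ; zero; suc; NonZero; _≤_; ∣_-_∣)
open import Relation.Binary.PropositionalEquality using (_≢_)

-- The free associative unital algebra over a commutative coefficient ring R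
-- on generators u_i, d_i (i ≥ 1), presented syntactically: terms modulo the
-- least congruence making them an associative unital R-algebra.
module FreeAlg {c ℓ} (R : CommutativeRing c ℓ) where
  open CommutativeRing R
    using ()
    renaming (Carrier to K; _≈_ to _≈ᴷ_; _+_ to _+ᴷ_; _*_ to _*ᴷ_; 0# to 0ᴷ; 1# to 1ᴷ)

  data Gen : Set where
    u : (i : ℕ) → .{{NonZero i}} → Gen
    d : (i : ℕ) → .{{NonZero i}} → Gen

  infixl 6 _⊕_ _⊖_
  infixl 7 _⊗_
  infix 4 _≈U_

  data Tm : Set c where
    gen : Gen → Tm
    sc  : K → Tm              -- scalar multiple of the identity
    _⊕_ : Tm → Tm → Tm
    _⊗_ : Tm → Tm → Tm
    ⊖_  : Tm → Tm

  𝟘 𝟙 : Tm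
  𝟘 = sc 0ᴷ
  𝟙 = sc 1ᴷ

  _⊖_ : Tm → Tm → Tm
  x ⊖ y = x ⊕ (⊖ y)

  data _≈U_ : Tm → Tm → Set (c ⊔ ℓ) where
    ≈-refl  : ∀ {x} → x ≈U x
    ≈-sym   : ∀ {x y} → x ≈U y → y ≈U x
    ≈-trans : ∀ {x y z} → x ≈U y → y ≈U z → x ≈U z
    ⊕-cong  : ∀ {x x′ y y′} → x ≈U x′ → y ≈U y′ → x ⊕ y ≈U x′ ⊕ y′
    ⊗-cong  : ∀ {x x′ y y′} → x ≈U x′ → y ≈U y′ → x ⊗ y ≈U x′ ⊗ y′
    ⊖-cong  : ∀ {x x′} → x ≈U x′ → ⊖ x ≈U ⊖ x′
    ⊕-assoc : ∀ x y z → (x ⊕ y) ⊕ z ≈U x ⊕ (y ⊕ z)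
    ⊕-comm  : ∀ x y → x ⊕ y ≈U y ⊕ x
    ⊕-idˡ   : ∀ x → 𝟘 ⊕ x ≈U x
    ⊖-invˡ  : ∀ x → (⊖ x) ⊕ x ≈U 𝟘
    ⊗-assoc : ∀ x y z → (x ⊗ y) ⊗ z ≈U x ⊗ (y ⊗ z)
    ⊗-idˡ   : ∀ x → 𝟙 ⊗ x ≈U x
    ⊗-idʳ   : ∀ x → x ⊗ 𝟙 ≈U x
    distribˡ : ∀ x y z → x ⊗ (y ⊕ z) ≈U (x ⊗ y) ⊕ (x ⊗ z)
    distribʳ : ∀ x y z → (y ⊕ z) ⊗ x ≈U (y ⊗ x) ⊕ (z ⊗ x)
    sc-cong  : ∀ {a b} → a ≈ᴷ b → sc a ≈U sc b
    sc-+     : ∀ a b → sc (a +ᴷ b) ≈U sc a ⊕ sc b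
    sc-*     : ∀ a b → sc (a *ᴷ b) ≈U sc a ⊗ sc b
    sc-central : ∀ a x → sc a ⊗ x ≈U x ⊗ sc a

  data Relator : Tm → Set where
    uu : ∀ i j .{{_ : NonZero i}} .{{_ : NonZero j}} → 2 ≤ ∣ i - j ∣ →
         Relator (gen (u i) ⊗ gen (u j) ⊖ gen (u j) ⊗ gen (u i))
    dd : ∀ i j .{{_ : NonZero i}} .{{_ : NonZero j}} → 2 ≤ ∣ i - j ∣ →
         Relator (gen (d i) ⊗ gen (d j) ⊖ gen (d j) ⊗ gen (d i))
    du : ∀ i j .{{_ : NonZero i}} .{{_ : NonZero j}} → i ≢ j →
         Relator (gen (d i) ⊗ gen (u j) ⊖ gen (u j) ⊗ gen (d i))
    d1u1 : Relator (gen (d 1) ⊗ gen (u 1) ⊖ 𝟙)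
    dusucc : ∀ i .{{_ : NonZero i}} →
         Relator (gen (d (suc i)) ⊗ gen (u (suc i)) ⊖ gen (u i) ⊗ gen (d i))

  data InJ : Tm → Set (c ⊔ ℓ) where
    rel  : ∀ {r} → Relator r → InJ r
    zer  : InJ 𝟘
    add  : ∀ {x y} → InJ x → InJ y → InJ (x ⊕ y)
    mulˡ : ∀ {x} (a : Tm) → InJ x → InJ (a ⊗ x)
    mulʳ : ∀ {x} (a : Tm) → InJ x → InJ (x ⊗ a)
    resp : ∀ {x y} → x ≈U y → InJ x → InJ y

  dProd : ℕ → Tm
  dProd zero    = 𝟙
  dProd (suc n) = dProd n ⊗ gen (d (suc n))

  uProd : ℕ → Tm
  uProd zero    = 𝟙
  uProd (suc n) = gen (u (suc n)) ⊗ uProd n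

module Submission where

open import Defs
open import Algebra.Bundles using (CommutativeRing)
open import Data.Nat.Base using (ℕ; zero; suc; _≤_)
open import Data.Product using (∃; _×_; _,_)
open import Level using (_⊔_)
open import Relation.Binary.Structures using (IsEquivalence; IsPreorder)
import Relation.Binary.Reasoning.Base.Double as PreorderReasoning

-- Modulo J the relation d_{i+1} u_{i+1} = u_i d_i lets d_{m+1} travel
-- through u_{m+1} u_m ⋯ u_1 until d_1 u_1 = 1 absorbs it, deleting u_{m+1};
-- peeling d_n, d_{n-1}, …, d_1 off d_1 ⋯ d_n u_n ⋯ u_1 in turn leaves 1.

module Congruence {c ℓ} (R : CommutativeRing c ℓ) where
  open FreeAlg R

  ≈U-isEquivalence : IsEquivalence _≈U_
  ≈U-isEquivalence = record { refl = ≈-refl ; sym = ≈-sym ; trans = ≈-trans }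

  ⊕-idʳ : ∀ x → x ⊕ 𝟘 ≈U x
  ⊕-idʳ x = ≈-trans (⊕-comm x 𝟘) (⊕-idˡ x)

  ⊕-⊖-cancelʳ : ∀ x y → (x ⊕ y) ⊖ x ≈U y
  ⊕-⊖-cancelʳ x y =
    ≈-trans (⊕-cong (⊕-comm x y) ≈-refl)
    (≈-trans (⊕-assoc y x (⊖ x))
    (≈-trans (⊕-cong ≈-refl (≈-trans (⊕-comm x (⊖ x)) (⊖-invˡ x)))
    (⊕-idʳ y)))

  infix 4 _≡ᴶ_

  _≡ᴶ_ : Tm → Tm → Set (c ⊔ ℓ)
  x ≡ᴶ y = ∃ λ t → InJ t × x ≈U y ⊕ t

  ≈⇒≡ᴶ : ∀ {x y} → x ≈U y → x ≡ᴶ y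
  ≈⇒≡ᴶ {y = y} x≈y = 𝟘 , zer , ≈-trans x≈y (≈-sym (⊕-idʳ y))

  ≡ᴶ-trans : ∀ {x y z} → x ≡ᴶ y → y ≡ᴶ z → x ≡ᴶ z
  ≡ᴶ-trans {z = z} (t , t∈J , x≈y+t) (s , s∈J , y≈z+s) =
    s ⊕ t , add s∈J t∈J ,
    ≈-trans x≈y+t (≈-trans (⊕-cong y≈z+s ≈-refl) (⊕-assoc z s t))

  ≡ᴶ-isPreorder : IsPreorder _≈U_ _≡ᴶ_
  ≡ᴶ-isPreorder = record
    { isEquivalence = ≈U-isEquivalence
    ; reflexive     = ≈⇒≡ᴶ
    ; trans         = ≡ᴶ-trans
    }

  ⊗-congˡ-≡ᴶ : ∀ a {x y} → x ≡ᴶ y → a ⊗ x ≡ᴶ a ⊗ y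
  ⊗-congˡ-≡ᴶ a {y = y} (t , t∈J , x≈y+t) =
    a ⊗ t , mulˡ a t∈J , ≈-trans (⊗-cong ≈-refl x≈y+t) (distribˡ a y t)

  ⊗-congʳ-≡ᴶ : ∀ a {x y} → x ≡ᴶ y → x ⊗ a ≡ᴶ y ⊗ a
  ⊗-congʳ-≡ᴶ a {y = y} (t , t∈J , x≈y+t) =
    t ⊗ a , mulʳ a t∈J , ≈-trans (⊗-cong x≈y+t ≈-refl) (distribʳ a y t)

  Relator⇒≡ᴶ : ∀ {x y} → Relator (x ⊖ y) → x ≡ᴶ y
  Relator⇒≡ᴶ {x} {y} r = x ⊖ y , rel r , ≈-sym (≈-trans (⊕-comm y (x ⊖ y)) xy-cancel)
    where
    xy-cancel : (x ⊖ y) ⊕ y ≈U x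
    xy-cancel = ≈-trans (⊕-assoc x (⊖ y) y)
                (≈-trans (⊕-cong ≈-refl (⊖-invˡ y)) (⊕-idʳ x))

  ≡ᴶ⇒InJ-⊖ : ∀ {x y} → x ≡ᴶ y → InJ (x ⊖ y)
  ≡ᴶ⇒InJ-⊖ {y = y} (t , t∈J , x≈y+t) =
    resp (≈-sym (≈-trans (⊕-cong x≈y+t ≈-refl) (⊕-⊖-cancelʳ y t))) t∈J

  open PreorderReasoning ≡ᴶ-isPreorder

  d-absorbs-uProd : ∀ m → gen (d (suc m)) ⊗ uProd (suc m) ≡ᴶ uProd m
  d-absorbs-uProd zero = begin
    d₁ ⊗ (u₁ ⊗ 𝟙)  ≈⟨ ⊗-cong ≈-refl (⊗-idʳ u₁) ⟩
    d₁ ⊗ u₁        ≲⟨ Relator⇒≡ᴶ d1u1 ⟩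
    𝟙              ∎
    where
    d₁ u₁ : Tm
    d₁ = gen (d 1)
    u₁ = gen (u 1)
  d-absorbs-uProd (suc m) = begin
    dₘ₊₂ ⊗ (uₘ₊₂ ⊗ uProd (suc m))  ≈⟨ ≈-sym (⊗-assoc dₘ₊₂ uₘ₊₂ (uProd (suc m))) ⟩
    (dₘ₊₂ ⊗ uₘ₊₂) ⊗ uProd (suc m)  ≲⟨ ⊗-congʳ-≡ᴶ (uProd (suc m)) (Relator⇒≡ᴶ (dusucc (suc m))) ⟩
    (uₘ₊₁ ⊗ dₘ₊₁) ⊗ uProd (suc m)  ≈⟨ ⊗-assoc uₘ₊₁ dₘ₊₁ (uProd (suc m)) ⟩
    uₘ₊₁ ⊗ (dₘ₊₁ ⊗ uProd (suc m))  ≲⟨ ⊗-congˡ-≡ᴶ uₘ₊₁ (d-absorbs-uProd m) ⟩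
    uₘ₊₁ ⊗ uProd m                 ∎
    where
    dₘ₊₁ uₘ₊₁ dₘ₊₂ uₘ₊₂ : Tm
    dₘ₊₁ = gen (d (suc m))
    uₘ₊₁ = gen (u (suc m))
    dₘ₊₂ = gen (d (suc (suc m)))
    uₘ₊₂ = gen (u (suc (suc m)))

  dProd⊗uProd≡ᴶ𝟙 : ∀ n → dProd n ⊗ uProd n ≡ᴶ 𝟙
  dProd⊗uProd≡ᴶ𝟙 zero    = ≈⇒≡ᴶ (⊗-idˡ 𝟙)
  dProd⊗uProd≡ᴶ𝟙 (suc n) = begin
    (dProd n ⊗ dₙ₊₁) ⊗ uProd (suc n)  ≈⟨ ⊗-assoc (dProd n) dₙ₊₁ (uProd (suc n)) ⟩
    dProd n ⊗ (dₙ₊₁ ⊗ uProd (suc n))  ≲⟨ ⊗-congˡ-≡ᴶ (dProd n) (d-absorbs-uProd n) ⟩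
    dProd n ⊗ uProd n                 ≲⟨ dProd⊗uProd≡ᴶ𝟙 n ⟩
    𝟙                                 ∎
    where
    dₙ₊₁ : Tm
    dₙ₊₁ = gen (d (suc n))

lemma3p5 : ∀ {c ℓ} (R : CommutativeRing c ℓ) → let open FreeAlg R in
    (n : ℕ) → 1 ≤ n → InJ (dProd n ⊗ uProd n ⊖ 𝟙)
lemma3p5 R n _ = ≡ᴶ⇒InJ-⊖ (dProd⊗uProd≡ᴶ𝟙 n)
  where open Congruence R
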